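{- Let $\mathbb{F}_q$ be a finite field, $r$ a prime divisor of $q-1$, $\rho\in\mathbb{F}_q$ a primitive $r$-th root of unity, $\alpha\in\mathbb{F}_q^\times$ and $\beta=\alpha^r$. For $a\in\mathbb{F}_q$ with $a^r\neq\beta$ put $\psi_a(x)=\frac{a-x}{a-\rho x}$. Let $N>1$ be a prime power with $N\neq r$, let $D$ be a positive integer, and let $\zeta_N\in\mathbb{F}_q$ be a primitive $N$-th root of unity. Suppose that for each $0\leq i<r$ we have $\psi_a(\rho^i\alpha)^D=\zeta_N^{n_i}$ for some $n_i\in(\mathbb{Z}/N\mathbb{Z})^\times$. Then there exist $i$ and $j$ with $n_i\neq n_j$. -}

module Defs where

open import Level using (Level; _⊔_; suc)
open import Data.Nat using (ℕ; _<_)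
open import Data.Fin using (Fin)
open import Data.Product using (∃)
open import Relation.Nullary using (¬_)
open import Relation.Binary.PropositionalEquality using (_≡_)
open import Algebra.Bundles using (CommutativeRing; Semiring)
import Algebra.Definitions.RawSemiring as RawSemiringDefs

-- The inverse is a total
-- operation _⁻¹ (its value at 0 is irrelevant: it is only ever applied
-- to nonzero elements in the statement).
record FiniteField (c ℓ : Level) : Set (suc (c ⊔ ℓ)) where
  field
    commutativeRing : CommutativeRing c ℓ
  open CommutativeRing commutativeRing public
  open RawSemiringDefs (Semiring.rawSemiring semiring) public using (_^_)
  field
    _⁻¹     : Carrier → Carrier
    ⁻¹-cong : ∀ {x y} → x ≈ y → x ⁻¹ ≈ y ⁻¹
    inverse : ∀ x → ¬ (x ≈ 0#) → x * (x ⁻¹) ≈ 1#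
    0≉1     : ¬ (0# ≈ 1#)
    q       : ℕ
    enum    : Fin q → Carrier
    enum-surjective : ∀ x → ∃ λ i → enum i ≈ x
    enum-injective  : ∀ i j → enum i ≈ enum j → i ≡ j

  _÷_ : Carrier → Carrier → Carrier
  x ÷ y = x * (y ⁻¹)

  IsPrimitiveRoot : ℕ → Carrier → Set ℓ
  IsPrimitiveRoot n ζ = (ζ ^ n ≈ 1#) × (∀ k → 0 < k → k < n → ¬ (ζ ^ k ≈ 1#))
    where open import Data.Product using (_×_)

  ψ : Carrier → Carrier → Carrier → Carrier
  ψ ρ a x = (a - x) ÷ (a - ρ * x)

{-# OPTIONS --safe #-}
module Submission where

-- Writing u i = a - ρⁱα, one has ψ_a(ρⁱα) = u i / u (i+1), and u r = u 0 since ρʳ = 1; the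
-- hypothesis aʳ ≠ αʳ makes every u i nonzero, so the product of the r values ψ_a(ρⁱα)
-- telescopes to 1.  If all nᵢ were equal to m, raising that product to the D-th power
-- would give ζ^(m r) = 1, hence N ∣ m r, hence N ∣ r because m is a unit mod N; as r is
-- prime, N = 1 or N = r, both excluded.

open import Defs
open import Data.Nat using (ℕ; _∸_; _>_; _≤_) renaming (_^_ to _^ℕ_)
open import Data.Nat.Divisibility using (_∣_)
open import Data.Nat.Primality using (Prime)
open import Data.Nat.Coprimality using (Coprime)
open import Data.Fin using (Fin; toℕ)
open import Data.Product using (∃; ∃-syntax; _×_)
open import Relation.Nullary using (¬_)
open import Relation.Binary.PropositionalEquality using (_≡_; _≢_)

open import Data.Nat using (zero; suc; _<_; NonZero)
import Data.Nat as ℕ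
import Data.Nat.Properties as ℕₚ
open import Data.Nat.DivMod using (_%_; _/_; m≡m%n+[m/n]*n; m%n<n)
open import Data.Nat.Divisibility using (m%n≡0⇒n∣m)
open import Data.Nat.Primality using (prime⇒irreducible)
import Data.Nat.Coprimality as Coprime
import Data.Fin as Fin
import Data.Fin.Properties as Finₚ
open import Data.Product using (_,_)
open import Data.Sum using (inj₁; inj₂)
open import Level using (Level)
open import Relation.Nullary using (yes; no; contradiction)
import Relation.Binary.PropositionalEquality as ≡
import Algebra.Properties.Group as GroupProperties
import Algebra.Properties.Semiring.Exp as SemiringExp
import Algebra.Properties.CommutativeSemiring.Exp as CommutativeSemiringExp

module FieldProperties {c ℓ : Level} (F : FiniteField c ℓ) where
  open FiniteField F
  open SemiringExp semiring using (^-congˡ; ^-homo-*; ^-assocʳ)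
  open CommutativeSemiringExp commutativeSemiring using (^-distrib-*)
  open GroupProperties +-group using (x∙y⁻¹≈ε⇒x≈y)
  open import Relation.Binary.Reasoning.Setoid setoid

  1^n≈1 : ∀ n → 1# ^ n ≈ 1#
  1^n≈1 zero    = refl
  1^n≈1 (suc n) = trans (*-identityˡ _) (1^n≈1 n)

  x*y≈y⇒x≈1 : ∀ {x y} → ¬ (y ≈ 0#) → x * y ≈ y → x ≈ 1#
  x*y≈y⇒x≈1 {x} {y} y≉0 xy≈y = begin
    x                ≈⟨ *-identityʳ x ⟨
    x * 1#           ≈⟨ *-congˡ (inverse y y≉0) ⟨
    x * (y * y ⁻¹)   ≈⟨ *-assoc x y (y ⁻¹) ⟨
    (x * y) * y ⁻¹   ≈⟨ *-congʳ xy≈y ⟩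
    y * y ⁻¹         ≈⟨ inverse y y≉0 ⟩
    1#               ∎

  ^-root-of-unity : ∀ {ρ} r → ρ ^ r ≈ 1# → ∀ i → (ρ ^ i) ^ r ≈ 1#
  ^-root-of-unity {ρ} r ρ^r≈1 i = begin
    (ρ ^ i) ^ r    ≈⟨ ^-assocʳ ρ i r ⟩
    ρ ^ (i ℕ.* r)  ≡⟨ ≡.cong (ρ ^_) (ℕₚ.*-comm i r) ⟩
    ρ ^ (r ℕ.* i)  ≈⟨ ^-assocʳ ρ r i ⟨
    (ρ ^ r) ^ i    ≈⟨ ^-congˡ i ρ^r≈1 ⟩
    1# ^ i         ≈⟨ 1^n≈1 i ⟩
    1#             ∎

  ^-mod : ∀ {ζ} N .{{_ : NonZero N}} → ζ ^ N ≈ 1# → ∀ t → ζ ^ t ≈ ζ ^ (t % N)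
  ^-mod {ζ} N ζ^N≈1 t = begin
    ζ ^ t                                ≡⟨ ≡.cong (ζ ^_) (m≡m%n+[m/n]*n t N) ⟩
    ζ ^ (t % N ℕ.+ t / N ℕ.* N)          ≈⟨ ^-homo-* ζ (t % N) (t / N ℕ.* N) ⟩
    ζ ^ (t % N) * ζ ^ (t / N ℕ.* N)      ≡⟨ ≡.cong (λ e → ζ ^ (t % N) * ζ ^ e) (ℕₚ.*-comm (t / N) N) ⟩
    ζ ^ (t % N) * ζ ^ (N ℕ.* (t / N))    ≈⟨ *-congˡ (^-assocʳ ζ N (t / N)) ⟨
    ζ ^ (t % N) * (ζ ^ N) ^ (t / N)      ≈⟨ *-congˡ (trans (^-congˡ (t / N) ζ^N≈1) (1^n≈1 (t / N))) ⟩
    ζ ^ (t % N) * 1#                     ≈⟨ *-identityʳ _ ⟩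
    ζ ^ (t % N)                          ∎

  primitiveRoot⇒order∣ : ∀ {ζ} N .{{_ : NonZero N}} → IsPrimitiveRoot N ζ →
                         ∀ t → ζ ^ t ≈ 1# → N ∣ t
  primitiveRoot⇒order∣ {ζ} N (ζ^N≈1 , minimal) t ζ^t≈1 with t % N ℕₚ.≟ 0
  ... | yes t%N≡0 = m%n≡0⇒n∣m t N t%N≡0
  ... | no  t%N≢0 = contradiction (trans (sym (^-mod N ζ^N≈1 t)) ζ^t≈1)
                                  (minimal (t % N) (ℕₚ.n≢0⇒n>0 t%N≢0) (m%n<n t N))

  ∏ : ℕ → (ℕ → Carrier) → Carrier
  ∏ zero    f = 1#
  ∏ (suc k) f = ∏ k f * f k

  ∏-cong : ∀ k {f g} → (∀ i → i < k → f i ≈ g i) → ∏ k f ≈ ∏ k g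
  ∏-cong zero    f≈g = refl
  ∏-cong (suc k) f≈g = *-cong (∏-cong k (λ i i<k → f≈g i (ℕₚ.m<n⇒m<1+n i<k))) (f≈g k ℕₚ.≤-refl)

  ∏-const : ∀ k x → ∏ k (λ _ → x) ≈ x ^ k
  ∏-const zero    x = refl
  ∏-const (suc k) x = trans (*-congʳ (∏-const k x)) (*-comm _ x)

  ∏-^ : ∀ k f n → ∏ k f ^ n ≈ ∏ k (λ i → f i ^ n)
  ∏-^ zero    f n = 1^n≈1 n
  ∏-^ (suc k) f n = trans (^-distrib-* (∏ k f) (f k) n) (*-congʳ (∏-^ k f n))

  ∏-telescope : ∀ (u : ℕ → Carrier) → (∀ i → ¬ (u i ≈ 0#)) →
                ∀ k → ∏ k (λ i → u i ÷ u (suc i)) * u k ≈ u 0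
  ∏-telescope u u≉0 zero    = *-identityˡ (u 0)
  ∏-telescope u u≉0 (suc k) = begin
    (P * (u k * u (suc k) ⁻¹)) * u (suc k)  ≈⟨ *-assoc P _ _ ⟩
    P * ((u k * u (suc k) ⁻¹) * u (suc k))  ≈⟨ *-congˡ (*-assoc (u k) _ _) ⟩
    P * (u k * (u (suc k) ⁻¹ * u (suc k)))  ≈⟨ *-congˡ (*-congˡ (trans (*-comm _ _) (inverse _ (u≉0 (suc k))))) ⟩
    P * (u k * 1#)                          ≈⟨ *-congˡ (*-identityʳ (u k)) ⟩
    P * u k                                 ≈⟨ ∏-telescope u u≉0 k ⟩
    u 0                                     ∎
    where P = ∏ k (λ i → u i ÷ u (suc i))

  module _ {r ρ} (ρ^r≈1 : ρ ^ r ≈ 1#) {α a} (a^r≉α^r : ¬ (a ^ r ≈ α ^ r)) where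

    private
      u : ℕ → Carrier
      u i = a - ρ ^ i * α

      u≉0 : ∀ i → ¬ (u i ≈ 0#)
      u≉0 i u≈0 = a^r≉α^r (begin
        a ^ r                  ≈⟨ ^-congˡ r (x∙y⁻¹≈ε⇒x≈y a _ u≈0) ⟩
        (ρ ^ i * α) ^ r        ≈⟨ ^-distrib-* (ρ ^ i) α r ⟩
        (ρ ^ i) ^ r * α ^ r    ≈⟨ *-congʳ (^-root-of-unity r ρ^r≈1 i) ⟩
        1# * α ^ r             ≈⟨ *-identityˡ (α ^ r) ⟩
        α ^ r                  ∎)

      ψ≈u÷u : ∀ i → ψ ρ a (ρ ^ i * α) ≈ u i ÷ u (suc i)
      ψ≈u÷u i = *-congˡ (⁻¹-cong (+-congˡ (-‿cong (sym (*-assoc ρ (ρ ^ i) α)))))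

    ∏-ψ-orbit≈1 : ∏ r (λ i → ψ ρ a (ρ ^ i * α)) ≈ 1#
    ∏-ψ-orbit≈1 = trans (∏-cong r (λ i _ → ψ≈u÷u i)) (x*y≈y⇒x≈1 (u≉0 0) telescoped)
      where
      telescoped : ∏ r (λ i → u i ÷ u (suc i)) * u 0 ≈ u 0
      telescoped = trans (*-congˡ (+-congˡ (-‿cong (*-congʳ (sym ρ^r≈1)))))
                         (∏-telescope u u≉0 r)

    ψ-orbit-constant-power : ∀ D ζ m → (∀ i → i < r → ψ ρ a (ρ ^ i * α) ^ D ≈ ζ ^ m) →
                             ζ ^ (m ℕ.* r) ≈ 1#
    ψ-orbit-constant-power D ζ m ψ^D≈ζ^m = begin
      ζ ^ (m ℕ.* r)                        ≈⟨ ^-assocʳ ζ m r ⟨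
      (ζ ^ m) ^ r                          ≈⟨ ∏-const r (ζ ^ m) ⟨
      ∏ r (λ _ → ζ ^ m)                    ≈⟨ ∏-cong r ψ^D≈ζ^m ⟨
      ∏ r (λ i → ψ ρ a (ρ ^ i * α) ^ D)    ≈⟨ ∏-^ r _ D ⟨
      ∏ r (λ i → ψ ρ a (ρ ^ i * α)) ^ D    ≈⟨ ^-congˡ D ∏-ψ-orbit≈1 ⟩
      1# ^ D                               ≈⟨ 1^n≈1 D ⟩
      1#                                   ∎

lemma3p8 : ∀ {c ℓ} (F : FiniteField c ℓ) → let open FiniteField F in
    (r : ℕ) → Prime r → r ∣ (q ∸ 1) →
    (ρ : Carrier) → IsPrimitiveRoot r ρ →
    (α : Carrier) → ¬ (α ≈ 0#) →
    (a : Carrier) → ¬ (a ^ r ≈ α ^ r) →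
    (N : ℕ) → (∃[ p ] ∃[ k ] (Prime p × 1 ≤ k × N ≡ p ^ℕ k)) → N > 1 → N ≢ r →
    (D : ℕ) → D > 0 →
    (ζ : Carrier) → IsPrimitiveRoot N ζ →
    (n : Fin r → Fin N) → (∀ i → Coprime (toℕ (n i)) N) →
    (∀ i → ψ ρ a ((ρ ^ toℕ i) * α) ^ D ≈ ζ ^ toℕ (n i)) →
    ∃[ i ] ∃[ j ] (n i ≢ n j)
lemma3p8 F r@(suc _) r-prime _ ρ (ρ^r≈1 , _) α _ a a^r≉α^r
         N@(suc _) _ N>1 N≢r D _ ζ ζ-primitive n n-coprime ψ^D≈ζ^n
  with Finₚ.¬∀⟶∃¬ r (λ i → n i ≡ n Fin.zero) (λ i → n i Finₚ.≟ n Fin.zero) not-all-equal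
  where
  open FiniteField F
  open FieldProperties F

  not-all-equal : ¬ (∀ i → n i ≡ n Fin.zero)
  not-all-equal all-equal with prime⇒irreducible r-prime N∣r
    where
    m : ℕ
    m = toℕ (n Fin.zero)

    ψ^D≈ζ^m : ∀ i → i < r → ψ ρ a (ρ ^ i * α) ^ D ≈ ζ ^ m
    ψ^D≈ζ^m i i<r with Fin.fromℕ< i<r | Finₚ.toℕ-fromℕ< i<r
    ... | j | ≡.refl = trans (ψ^D≈ζ^n j) (reflexive (≡.cong (λ k → ζ ^ toℕ k) (all-equal j)))

    N∣r : N ∣ r
    N∣r = Coprime.coprime-divisor (Coprime.sym (n-coprime Fin.zero))
            (primitiveRoot⇒order∣ N ζ-primitive (m ℕ.* r)
              (ψ-orbit-constant-power ρ^r≈1 a^r≉α^r D ζ m ψ^D≈ζ^m))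
  ... | inj₁ N≡1 = ℕₚ.<⇒≢ N>1 (≡.sym N≡1)
  ... | inj₂ N≡r = N≢r N≡r
... | i , nᵢ≢n₀ = i , Fin.zero , nᵢ≢n₀
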